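{- Every ap-trioid $(S,+,\cdot,\|,0,1_\sigma,1_\pi,a)$ is a dp-trioid with domain operation $d(x)=a(a(x))$.
   Context: A proto-trioid is a structure $(S,+,\cdot,\|,0,1_\sigma,1_\pi)$ such that $+$ is associative, commutative, idempotent with unit $0$ (order $x\le y\iff x+y=y$); $1_\sigma\cdot x=x=x\cdot 1_\sigma$, $x\cdot y+x\cdot z\le x\cdot(y+z)$, $(x+y)\cdot z=x\cdot z+y\cdot z$, $0\cdot x=0$; $\|$ is associative, commutative with unit $1_\pi$, $x\|(y+z)=x\|y+x\|z$, $x\|0=0$. An ap-trioid is a proto-trioid with unary $a$ satisfying: $x\cdot(y\cdot z)=(x\cdot y)\cdot z$ whenever one of $x,y,z$ is of the form $a(w)$; $a(x)\cdot x=0$; $a(x\cdot y)=a(x\cdot a(a(y)))$; $a(x)+a(a(x))=1_\sigma$; $a(x)\cdot(y+z)=a(x)\cdot y+a(x)\cdot z$; $(x\|y)\cdot a(z)=(x\cdot a(z))\|(y\cdot a(z))$; $a(x\|y)=a(x)+a(y)$; $a(x)\|a(y)=a(x)\cdot a(y)$. A dp-trioid is a proto-trioid with unary $d$ satisfying: $x\cdot(y\cdot z)=(x\cdot y)\cdot z$ whenever one of $x,y,z$ is of the form $d(w)$; $x\le d(x)\cdot x$; $d(x\cdot y)=d(x\cdot d(y))$; $d(x+y)=d(x)+d(y)$; $d(x)\le 1_\sigma$; $d(0)=0$; $(x\|y)\cdot d(z)=(x\cdot d(z))\|(y\cdot d(z))$; $d(x\|y)=d(x)\cdot d(y)$; $d(x)\|d(y)=d(x)\cdot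 d(y)$. -}

module Defs where

open import Level using (Level; suc; _⊔_)
open import Relation.Binary.PropositionalEquality using (_≡_)

record TrioidOps {ℓ : Level} (S : Set ℓ) : Set ℓ where
  field
    _+_  : S → S → S
    _·_  : S → S → S
    _∥_  : S → S → S
    𝟘    : S
    1σ   : S
    1π   : S

  infixl 6 _+_
  infixl 7 _·_
  infixl 7 _∥_

  _≤_ : S → S → Set ℓ
  x ≤ y = x + y ≡ y

module _ {ℓ : Level} {S : Set ℓ} (O : TrioidOps S) where
  open TrioidOps O

  record IsProtoTrioid : Set ℓ where
    field
      +-assoc  : ∀ x y z → (x + y) + z ≡ x + (y + z)
      +-comm   : ∀ x y → x + y ≡ y + x
      +-idem   : ∀ x → x + x ≡ x
      +-unit   : ∀ x → x + 𝟘 ≡ x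
      ·-unitˡ  : ∀ x → 1σ · x ≡ x
      ·-unitʳ  : ∀ x → x · 1σ ≡ x
      ·-subdistribˡ : ∀ x y z → (x · y + x · z) ≤ (x · (y + z))
      ·-distribʳ    : ∀ x y z → (x + y) · z ≡ x · z + y · z
      ·-zeroˡ  : ∀ x → 𝟘 · x ≡ 𝟘
      ∥-assoc  : ∀ x y z → (x ∥ y) ∥ z ≡ x ∥ (y ∥ z)
      ∥-comm   : ∀ x y → x ∥ y ≡ y ∥ x
      ∥-unit   : ∀ x → x ∥ 1π ≡ x
      ∥-distrib : ∀ x y z → x ∥ (y + z) ≡ x ∥ y + x ∥ z
      ∥-zero   : ∀ x → x ∥ 𝟘 ≡ 𝟘

  record IsApTrioid (a : S → S) : Set ℓ where
    field
      isProtoTrioid : IsProtoTrioid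
      ·-assoc-a₁ : ∀ w y z → a w · (y · z) ≡ (a w · y) · z
      ·-assoc-a₂ : ∀ x w z → x · (a w · z) ≡ (x · a w) · z
      ·-assoc-a₃ : ∀ x y w → x · (y · a w) ≡ (x · y) · a w
      a-annihil  : ∀ x → a x · x ≡ 𝟘
      a-local    : ∀ x y → a (x · y) ≡ a (x · a (a y))
      a-compl    : ∀ x → a x + a (a x) ≡ 1σ
      a-distribˡ : ∀ x y z → a x · (y + z) ≡ a x · y + a x · z
      a-∥-distrib : ∀ x y z → (x ∥ y) · a z ≡ (x · a z) ∥ (y · a z)
      a-∥        : ∀ x y → a (x ∥ y) ≡ a x + a y
      a-∥-·      : ∀ x y → a x ∥ a y ≡ a x · a y

  record IsDpTrioid (d : S → S) : Set ℓ where
    field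
      isProtoTrioid : IsProtoTrioid
      ·-assoc-d₁ : ∀ w y z → d w · (y · z) ≡ (d w · y) · z
      ·-assoc-d₂ : ∀ x w z → x · (d w · z) ≡ (x · d w) · z
      ·-assoc-d₃ : ∀ x y w → x · (y · d w) ≡ (x · y) · d w
      d-absorb   : ∀ x → x ≤ (d x · x)
      d-local    : ∀ x y → d (x · y) ≡ d (x · d y)
      d-add      : ∀ x y → d (x + y) ≡ d x + d y
      d-sub-id   : ∀ x → d x ≤ 1σ
      d-zero     : d 𝟘 ≡ 𝟘
      d-∥-distrib : ∀ x y z → (x ∥ y) · d z ≡ (x · d z) ∥ (y · d z)
      d-∥        : ∀ x y → d (x ∥ y) ≡ d x · d y
      d-∥-·      : ∀ x y → d x ∥ d y ≡ d x · d y

-- Antidomain elements ("tests") form a Boolean algebra under · and +: they commute because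
-- a x · a y = a x ∥ a y, and a q is the largest test annihilating q. From this one derives
-- the De Morgan law a (x + y) = a x · a y, which turns a-∥ into d-∥ and gives d-add via
-- a (a x · a y) = a (a x ∥ a y) = d x + d y. The remaining dp-axioms are instances of the
-- ap-axioms at antidomain elements, plus d x · x = x from a x · x = 0 and a x + d x = 1σ.
module Submission where

open import Defs
open import Level using (Level)
open import Relation.Binary.PropositionalEquality
open ≡-Reasoning

module ProtoTrioidProperties {ℓ : Level} {S : Set ℓ} {O : TrioidOps S} (P : IsProtoTrioid O) where
  open TrioidOps O
  open IsProtoTrioid P

  +-unitˡ : ∀ x → 𝟘 + x ≡ x
  +-unitˡ x = trans (+-comm 𝟘 x) (+-unit x)

  +-conicalˡ : ∀ x y → x + y ≡ 𝟘 → x ≡ 𝟘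
  +-conicalˡ x y x+y≡𝟘 = begin
    x             ≡⟨ sym (+-unit x) ⟩
    x + 𝟘         ≡⟨ cong (x +_) (sym x+y≡𝟘) ⟩
    x + (x + y)   ≡⟨ sym (+-assoc x x y) ⟩
    (x + x) + y   ≡⟨ cong (_+ y) (+-idem x) ⟩
    x + y         ≡⟨ x+y≡𝟘 ⟩
    𝟘             ∎

  +-conicalʳ : ∀ x y → x + y ≡ 𝟘 → y ≡ 𝟘
  +-conicalʳ x y x+y≡𝟘 = +-conicalˡ y x (trans (+-comm y x) x+y≡𝟘)

  x≤y+x : ∀ x y → x ≤ (y + x)
  x≤y+x x y = begin
    x + (y + x)   ≡⟨ cong (x +_) (+-comm y x) ⟩
    x + (x + y)   ≡⟨ sym (+-assoc x x y) ⟩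
    (x + x) + y   ≡⟨ cong (_+ y) (+-idem x) ⟩
    x + y         ≡⟨ +-comm x y ⟩
    y + x         ∎

module ApTrioidProperties {ℓ : Level} {S : Set ℓ} {O : TrioidOps S} {a : S → S} (H : IsApTrioid O a) where
  open TrioidOps O
  open IsApTrioid H
  open IsProtoTrioid isProtoTrioid
  open ProtoTrioidProperties isProtoTrioid

  a-1σ : a 1σ ≡ 𝟘
  a-1σ = trans (sym (·-unitʳ (a 1σ))) (a-annihil 1σ)

  a-𝟘 : a 𝟘 ≡ 1σ
  a-𝟘 = begin
    a 𝟘                  ≡⟨ sym (+-unitˡ (a 𝟘)) ⟩
    𝟘 + a 𝟘              ≡⟨ cong₂ (λ u v → u + a v) (sym a-1σ) (sym a-1σ) ⟩
    a 1σ + a (a 1σ)      ≡⟨ a-compl 1σ ⟩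
    1σ                   ∎

  a-·-comm : ∀ x y → a x · a y ≡ a y · a x
  a-·-comm x y = trans (sym (a-∥-· x y)) (trans (∥-comm (a x) (a y)) (a-∥-· y x))

  a-zeroʳ : ∀ x → a x · 𝟘 ≡ 𝟘
  a-zeroʳ x = begin
    a x · 𝟘      ≡⟨ cong (a x ·_) (sym a-1σ) ⟩
    a x · a 1σ   ≡⟨ a-·-comm x 1σ ⟩
    a 1σ · a x   ≡⟨ cong (_· a x) a-1σ ⟩
    𝟘 · a x      ≡⟨ ·-zeroˡ (a x) ⟩
    𝟘            ∎

  -- Locality makes a (p · a (a q)) = a (p · q) = a 𝟘 = 1σ.
  ·≡𝟘⇒·aa≡𝟘 : ∀ p q → p · q ≡ 𝟘 → p · a (a q) ≡ 𝟘
  ·≡𝟘⇒·aa≡𝟘 p q pq≡𝟘 = begin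
    p · a (a q)                      ≡⟨ sym (·-unitˡ _) ⟩
    1σ · (p · a (a q))               ≡⟨ cong (_· (p · a (a q))) a[p·aaq]≡1σ ⟨
    a (p · a (a q)) · (p · a (a q))  ≡⟨ a-annihil _ ⟩
    𝟘                                ∎
    where
    a[p·aaq]≡1σ : a (p · a (a q)) ≡ 1σ
    a[p·aaq]≡1σ = trans (sym (a-local p q)) (trans (cong a pq≡𝟘) a-𝟘)

  a-·≡𝟘⇒≤a : ∀ p q → a p · q ≡ 𝟘 → a p ≡ a p · a q
  a-·≡𝟘⇒≤a p q apq≡𝟘 = begin
    a p                              ≡⟨ sym (·-unitʳ _) ⟩
    a p · 1σ                         ≡⟨ cong (a p ·_) (sym (a-compl q)) ⟩
    a p · (a q + a (a q))            ≡⟨ a-distribˡ p _ _ ⟩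
    a p · a q + a p · a (a q)        ≡⟨ cong (a p · a q +_) (·≡𝟘⇒·aa≡𝟘 (a p) q apq≡𝟘) ⟩
    a p · a q + 𝟘                    ≡⟨ +-unit _ ⟩
    a p · a q                        ∎

  a·a-distribˡ : ∀ u v s t → (a u · a v) · (s + t) ≡ (a u · a v) · s + (a u · a v) · t
  a·a-distribˡ u v s t = begin
    (a u · a v) · (s + t)              ≡⟨ sym (·-assoc-a₁ u (a v) (s + t)) ⟩
    a u · (a v · (s + t))              ≡⟨ cong (a u ·_) (a-distribˡ v s t) ⟩
    a u · (a v · s + a v · t)          ≡⟨ a-distribˡ u _ _ ⟩
    a u · (a v · s) + a u · (a v · t)  ≡⟨ cong₂ _+_ (·-assoc-a₁ u (a v) s) (·-assoc-a₁ u (a v) t) ⟩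
    (a u · a v) · s + (a u · a v) · t  ∎

  a·a-comm : ∀ x y z → (a x · a y) · a z ≡ a z · (a x · a y)
  a·a-comm x y z = begin
    (a x · a y) · a z   ≡⟨ sym (·-assoc-a₁ x (a y) (a z)) ⟩
    a x · (a y · a z)   ≡⟨ cong (a x ·_) (a-·-comm y z) ⟩
    a x · (a z · a y)   ≡⟨ ·-assoc-a₁ x (a z) (a y) ⟩
    (a x · a z) · a y   ≡⟨ cong (_· a y) (a-·-comm x z) ⟩
    (a z · a x) · a y   ≡⟨ sym (·-assoc-a₁ z (a x) (a y)) ⟩
    a z · (a x · a y)   ∎

  a·a-annihilˡ : ∀ x y → (a x · a y) · x ≡ 𝟘
  a·a-annihilˡ x y = begin
    (a x · a y) · x   ≡⟨ cong (_· x) (a-·-comm x y) ⟩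
    (a y · a x) · x   ≡⟨ sym (·-assoc-a₁ y (a x) x) ⟩
    a y · (a x · x)   ≡⟨ cong (a y ·_) (a-annihil x) ⟩
    a y · 𝟘           ≡⟨ a-zeroʳ y ⟩
    𝟘                 ∎

  a·a-annihilʳ : ∀ x y → (a x · a y) · y ≡ 𝟘
  a·a-annihilʳ x y = begin
    (a x · a y) · y   ≡⟨ sym (·-assoc-a₁ x (a y) y) ⟩
    a x · (a y · y)   ≡⟨ cong (a x ·_) (a-annihil y) ⟩
    a x · 𝟘           ≡⟨ a-zeroʳ x ⟩
    𝟘                 ∎

  -- Both sides are tests below each other: a (x + y) ≤ a x · a y since it annihilates x and y,
  -- and a x · a y ≤ a (x + y) since it annihilates x + y.
  a-+ : ∀ x y → a (x + y) ≡ a x · a y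
  a-+ x y = begin
    A        ≡⟨ A≡A·P ⟩
    A · P    ≡⟨ a·a-comm x y (x + y) ⟨
    P · A    ≡⟨ P≡P·A ⟨
    P        ∎
    where
    A = a (x + y)
    P = a x · a y

    A·x+A·y≡𝟘 : A · x + A · y ≡ 𝟘
    A·x+A·y≡𝟘 = trans (sym (a-distribˡ (x + y) x y)) (a-annihil (x + y))

    A≡A·P : A ≡ A · P
    A≡A·P = begin
      A                 ≡⟨ a-·≡𝟘⇒≤a (x + y) x (+-conicalˡ _ _ A·x+A·y≡𝟘) ⟩
      A · a x           ≡⟨ cong (_· a x) (a-·≡𝟘⇒≤a (x + y) y (+-conicalʳ _ _ A·x+A·y≡𝟘)) ⟩
      (A · a y) · a x   ≡⟨ sym (·-assoc-a₁ (x + y) (a y) (a x)) ⟩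
      A · (a y · a x)   ≡⟨ cong (A ·_) (a-·-comm y x) ⟩
      A · P             ∎

    P·[x+y]≡𝟘 : P · (x + y) ≡ 𝟘
    P·[x+y]≡𝟘 = begin
      P · (x + y)       ≡⟨ a·a-distribˡ x y x y ⟩
      P · x + P · y     ≡⟨ cong₂ _+_ (a·a-annihilˡ x y) (a·a-annihilʳ x y) ⟩
      𝟘 + 𝟘             ≡⟨ +-unit 𝟘 ⟩
      𝟘                 ∎

    P≡P·A : P ≡ P · A
    P≡P·A = begin
      P                 ≡⟨ sym (·-unitʳ P) ⟩
      P · 1σ            ≡⟨ cong (P ·_) (sym (a-compl (x + y))) ⟩
      P · (A + a A)     ≡⟨ a·a-distribˡ x y _ _ ⟩
      P · A + P · a A   ≡⟨ cong (P · A +_) (·≡𝟘⇒·aa≡𝟘 P (x + y) P·[x+y]≡𝟘) ⟩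
      P · A + 𝟘         ≡⟨ +-unit _ ⟩
      P · A             ∎

  aa-+ : ∀ x y → a (a (x + y)) ≡ a (a x) + a (a y)
  aa-+ x y = begin
    a (a (x + y))       ≡⟨ cong a (a-+ x y) ⟩
    a (a x · a y)       ≡⟨ cong a (a-∥-· x y) ⟨
    a (a x ∥ a y)       ≡⟨ a-∥ (a x) (a y) ⟩
    a (a x) + a (a y)   ∎

  aa-∥ : ∀ x y → a (a (x ∥ y)) ≡ a (a x) · a (a y)
  aa-∥ x y = trans (cong a (a-∥ x y)) (a-+ (a x) (a y))

  aa-≤-1σ : ∀ x → a (a x) ≤ 1σ
  aa-≤-1σ x = subst (a (a x) ≤_) (a-compl x) (x≤y+x (a (a x)) (a x))

  aa-·-identity : ∀ x → a (a x) · x ≡ x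
  aa-·-identity x = sym (begin
    x                          ≡⟨ sym (·-unitˡ x) ⟩
    1σ · x                     ≡⟨ cong (_· x) (sym (a-compl x)) ⟩
    (a x + a (a x)) · x        ≡⟨ ·-distribʳ _ _ _ ⟩
    a x · x + a (a x) · x      ≡⟨ cong (_+ a (a x) · x) (a-annihil x) ⟩
    𝟘 + a (a x) · x            ≡⟨ +-unitˡ _ ⟩
    a (a x) · x                ∎)

  aa-absorb : ∀ x → x ≤ (a (a x) · x)
  aa-absorb x = begin
    x + a (a x) · x   ≡⟨ cong (x +_) (aa-·-identity x) ⟩
    x + x             ≡⟨ +-idem x ⟩
    x                 ≡⟨ aa-·-identity x ⟨
    a (a x) · x       ∎

proposition11p4 : ∀ {ℓ : Level} {S : Set ℓ} (O : TrioidOps S) (a : S → S) → IsApTrioid O a → IsDpTrioid O (λ x → a (a x))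
proposition11p4 O a H = record
  { isProtoTrioid = isProtoTrioid
  ; ·-assoc-d₁ = λ w → ·-assoc-a₁ (a w)
  ; ·-assoc-d₂ = λ x w → ·-assoc-a₂ x (a w)
  ; ·-assoc-d₃ = λ x y w → ·-assoc-a₃ x y (a w)
  ; d-absorb = aa-absorb
  ; d-local = λ x y → cong a (a-local x y)
  ; d-add = aa-+
  ; d-sub-id = aa-≤-1σ
  ; d-zero = trans (cong a a-𝟘) a-1σ
  ; d-∥-distrib = λ x y z → a-∥-distrib x y (a z)
  ; d-∥ = aa-∥
  ; d-∥-· = λ x y → a-∥-· (a x) (a y)
  }
  where
  open IsApTrioid H
  open ApTrioidProperties H
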